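{- For any positive integer $n$, if $w\in V_{n+1}$ then $\varphi_n(w)\in V_n$.
   Context: $V_m\subseteq S_m$ is the set of permutations whose Schensted insertion produces no lateral bumps. Schensted insertion (French notation): insert $w_1,\dots,w_m$ successively into an initially empty tableau; a number $x$ inserted into a row is appended if it exceeds all entries (or the row is empty), otherwise it replaces the smallest entry $y>x$, and $y$ is bumped into the next row up and inserted by the same rule. A bump of $y$ from column $j$ is vertical if $y$ lands in column $j$ of the next row, and lateral otherwise. For an injective word $a_1\cdots a_m$ of reals, $\mathsf{Flat}(a_1\cdots a_m)=b_1\cdots b_m$ with $b_i=|\{j:a_j\le a_i\}|$, and $\varphi_n:S_{n+1}\to S_n$ is $\varphi_n(w_1\cdots w_{n+1})=\mathsf{Flat}(w_1\cdots w_n)$. -}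

module Defs where

open import Data.Nat using (ℕ; zero; suc; _<ᵇ_; _≤ᵇ_; _≡ᵇ_; _+_)
open import Data.Bool using (Bool; true; false; if_then_else_; _∧_; not; T)
open import Data.List using (List; []; _∷_; map; upTo; take; length; filter)
open import Data.Maybe using (Maybe; just; nothing)
open import Data.Product using (_×_; _,_)
open import Data.List.Relation.Binary.Permutation.Propositional using (_↭_)

IsPerm : ℕ → List ℕ → Set
IsPerm m w = w ↭ map suc (upTo m)

-- A tableau in French notation: list of rows, bottom row (row 1) first;
-- each row is listed left to right (column 0, 1, …).
Tableau : Set
Tableau = List (List ℕ)

-- Row insertion of x: returns (column where x lands, new row, bumped entry).
-- x replaces the first (= smallest, rows increase) entry y with x < y,
-- or is appended if no such entry exists.
insRow : ℕ → List ℕ → ℕ × List ℕ × Maybe ℕ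
insRow x [] = 0 , x ∷ [] , nothing
insRow x (y ∷ r) with x <ᵇ y
... | true  = 0 , x ∷ r , just y
... | false with insRow x r
...   | k , r' , b = suc k , y ∷ r' , b

-- Is a bump from column j to column k lateral?  (nothing = not a bump,
-- i.e. the initial insertion into the bottom row.)
lateral : Maybe ℕ → ℕ → Bool
lateral nothing  k = false
lateral (just j) k = not (j ≡ᵇ k)

-- Insert x into the rows of T, where x was bumped from column `from`
-- (nothing for the initial insertion).  Returns the new tableau and
-- whether some lateral bump occurred during this insertion.
insertFrom : ℕ → Maybe ℕ → Tableau → Tableau × Bool
insertFrom x from [] = (x ∷ []) ∷ [] , lateral from 0
insertFrom x from (r ∷ T) with insRow x r
... | k , r' , nothing = r' ∷ T , lateral from k
... | k , r' , just y with insertFrom y (just k) T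
...   | T' , l = r' ∷ T' , (lateral from k Data.Bool.∨ l)

schensted : Tableau → List ℕ → Tableau × Bool
schensted T [] = T , false
schensted T (x ∷ w) with insertFrom x nothing T
... | T' , l with schensted T' w
...   | T'' , l' = T'' , (l Data.Bool.∨ l')

noLateralBumps : List ℕ → Bool
noLateralBumps w with schensted [] w
... | _ , l = not l

V : ℕ → List ℕ → Set
V m w = IsPerm m w × T (noLateralBumps w)

Flat : List ℕ → List ℕ
Flat a = map (λ ai → length (filter (λ aj → Data.Bool.T? (aj ≤ᵇ ai)) a)) a

φ : ℕ → List ℕ → List ℕ
φ n w = Flat (take n w)

-- Schensted insertion only compares entries, so it commutes with every relabelling of the
-- entries that is strictly monotone on them; Flat relabels a word by the rank of each letter,
-- so Flat preserves the absence of lateral bumps.  The lateral-bump flag of a word is the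
-- disjunction of the flags of its successive insertions, so prefixes of a word in V inherit
-- the property.  Finally, the rank of a letter does not change when the word is rearranged, so
-- Flat of an injective word is a rearrangement of Flat of its increasing sorting, which is
-- 1 2 ⋯ n.
module Submission where

open import Defs
open import Data.Bool using (Bool; true; false; not; T; T?; _∨_)
open import Data.Bool.Properties using (∨-assoc; ∨-conicalˡ; T-not-≡)
open import Data.List using (List; []; _∷_; _++_; map; filter; length; take; drop; upTo; applyUpTo)
open import Data.List.Properties
  using ( map-∘; map-cong; map-cong-local; map-upTo; filter-accept; filter-reject; filter-none
        ; take++drop≡id; length-take; length-map; length-upTo)
open import Data.List.Membership.Propositional using (_∈_)
open import Data.List.Relation.Unary.All as All using (All; []; _∷_)
open import Data.List.Relation.Unary.Any using (here; there)
open import Data.List.Relation.Unary.AllPairs as AllPairs using (AllPairs; []; _∷_)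
open import Data.List.Relation.Unary.Unique.Propositional using (Unique)
open import Data.List.Relation.Unary.Unique.Propositional.Properties as Unique using ()
open import Data.List.Relation.Binary.Permutation.Propositional
  using (_↭_; ↭-sym; ↭⇒↭ₛ; module PermutationReasoning)
open import Data.List.Relation.Binary.Permutation.Propositional.Properties
  using (↭-length; filter-↭; map⁺)
import Data.List.Relation.Binary.Permutation.Setoid.Properties as ↭ₛ
open import Data.List.Relation.Unary.Sorted.TotalOrder.Properties using (Sorted⇒AllPairs)
open import Data.Maybe as Maybe using (Maybe; just; nothing)
open import Data.Maybe.Relation.Unary.All as MaybeAll using (just; nothing)
open import Data.Nat using (ℕ; suc; _≤_; _<_; _<ᵇ_; _≤ᵇ_; z≤n; s≤s)
open import Data.Nat.Properties
open import Data.Product using (_×_; _,_; proj₁; proj₂; map₁)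
open import Function using (id; _∘_; Equivalence)
open import Relation.Binary.Definitions using (tri<; tri≈; tri>)
open import Relation.Binary.PropositionalEquality
open import Relation.Nullary using (yes; no; contradiction)
open import Relation.Nullary.Reflects using (det; fromEquivalence)

open import Data.List.Sort ≤-decTotalOrder using (sort; sort-↭; sort-↗)

rank : List ℕ → ℕ → ℕ
rank a x = length (filter (λ y → T? (y ≤ᵇ x)) a)

rank-∷-≤ : ∀ {y x} a → y ≤ x → rank (y ∷ a) x ≡ suc (rank a x)
rank-∷-≤ {y} {x} a y≤x = cong length (filter-accept (λ z → T? (z ≤ᵇ x)) {y} {a} (≤⇒≤ᵇ y≤x))

rank-∷-> : ∀ {y x} a → x < y → rank (y ∷ a) x ≡ rank a x
rank-∷-> {y} {x} a x<y =
  cong length (filter-reject (λ z → T? (z ≤ᵇ x)) {y} {a} (λ y≤x → <⇒≱ x<y (≤ᵇ⇒≤ y x y≤x)))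

rank-mono : ∀ a {x y} → x ≤ y → rank a x ≤ rank a y
rank-mono [] x≤y = z≤n
rank-mono (z ∷ a) {x} {y} x≤y with z ≤? x | z ≤? y
... | yes z≤x | _ rewrite rank-∷-≤ a z≤x | rank-∷-≤ a (≤-trans z≤x x≤y) =
  s≤s (rank-mono a x≤y)
... | no z≰x | yes z≤y rewrite rank-∷-> a (≰⇒> z≰x) | rank-∷-≤ a z≤y =
  m≤n⇒m≤1+n (rank-mono a x≤y)
... | no z≰x | no z≰y rewrite rank-∷-> a (≰⇒> z≰x) | rank-∷-> a (≰⇒> z≰y) =
  rank-mono a x≤y

rank-strictMono : ∀ {a x y} → y ∈ a → x < y → rank a x < rank a y
rank-strictMono {y ∷ a} (here refl) x<y rewrite rank-∷-> a x<y | rank-∷-≤ a (≤-refl {y}) =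
  s≤s (rank-mono a (<⇒≤ x<y))
rank-strictMono {z ∷ a} {x} {y} (there y∈a) x<y with z ≤? x | z ≤? y
... | yes z≤x | _ rewrite rank-∷-≤ a z≤x | rank-∷-≤ a (≤-trans z≤x (<⇒≤ x<y)) =
  s≤s (rank-strictMono y∈a x<y)
... | no z≰x | yes z≤y rewrite rank-∷-> a (≰⇒> z≰x) | rank-∷-≤ a z≤y =
  m<n⇒m<1+n (rank-strictMono y∈a x<y)
... | no z≰x | no z≰y rewrite rank-∷-> a (≰⇒> z≰x) | rank-∷-> a (≰⇒> z≰y) =
  rank-strictMono y∈a x<y

rank-resp-↭ : ∀ {a b} → a ↭ b → ∀ x → rank a x ≡ rank b x
rank-resp-↭ a↭b x = ↭-length (filter-↭ (λ y → T? (y ≤ᵇ x)) a↭b)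

rank-below-min : ∀ {x a} → All (x <_) a → rank a x ≡ 0
rank-below-min {x} x<a =
  cong length (filter-none (λ y → T? (y ≤ᵇ x)) (All.map (λ x<y y≤x → <⇒≱ x<y (≤ᵇ⇒≤ _ x y≤x)) x<a))

Flat-increasing : ∀ {s} → AllPairs _<_ s → Flat s ≡ map suc (upTo (length s))
Flat-increasing [] = refl
Flat-increasing {x ∷ s} (x<s ∷ s↑) = cong₂ _∷_ rank-min ranks-above-min
  where
  rank-min : rank (x ∷ s) x ≡ 1
  rank-min = trans (rank-∷-≤ s ≤-refl) (cong suc (rank-below-min x<s))
  ranks-above-min : map (rank (x ∷ s)) s ≡ map suc (applyUpTo suc (length s))
  ranks-above-min = begin
    map (rank (x ∷ s)) s                 ≡⟨ map-cong-local (All.map (rank-∷-≤ s ∘ <⇒≤) x<s) ⟩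
    map (suc ∘ rank s) s                 ≡⟨ map-∘ s ⟩
    map suc (Flat s)                     ≡⟨ cong (map suc) (Flat-increasing s↑) ⟩
    map suc (map suc (upTo (length s)))  ≡⟨ cong (map suc) (map-upTo suc (length s)) ⟩
    map suc (applyUpTo suc (length s))   ∎
    where open ≡-Reasoning

Unique-resp-↭ : ∀ {a b : List ℕ} → a ↭ b → Unique a → Unique b
Unique-resp-↭ a↭b = ↭ₛ.Unique-resp-↭ (setoid ℕ) (↭⇒↭ₛ a↭b)

sort-increasing : ∀ {a} → Unique a → AllPairs _<_ (sort a)
sort-increasing {a} a! = AllPairs.zipWith (λ (x≤y , x≢y) → ≤∧≢⇒< x≤y x≢y)
  (Sorted⇒AllPairs ≤-totalOrder (sort-↗ a) , Unique-resp-↭ (↭-sym (sort-↭ a)) a!)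

Flat-isPerm : ∀ {a} → Unique a → IsPerm (length a) (Flat a)
Flat-isPerm {a} a! = begin
  map (rank a) a                        ↭⟨ map⁺ (rank a) (↭-sym (sort-↭ a)) ⟩
  map (rank a) (sort a)                 ≡⟨ map-cong (rank-resp-↭ (↭-sym (sort-↭ a))) (sort a) ⟩
  Flat (sort a)                         ≡⟨ Flat-increasing (sort-increasing a!) ⟩
  map suc (upTo (length (sort a)))      ≡⟨ cong (map suc ∘ upTo) (↭-length (sort-↭ a)) ⟩
  map suc (upTo (length a))             ∎
  where open PermutationReasoning

module Relabelling (S : ℕ → Set) (f : ℕ → ℕ)
                   (f-strictMono : ∀ {x y} → S x → S y → x < y → f x < f y) where

  f-reflects-< : ∀ {x y} → S x → S y → f x < f y → x < y
  f-reflects-< {x} {y} sx sy fx<fy with <-cmp x y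
  ... | tri< x<y _ _ = x<y
  ... | tri≈ _ refl _ = contradiction fx<fy (<-irrefl refl)
  ... | tri> _ _ y<x = contradiction fx<fy (<⇒≯ (f-strictMono sy sx y<x))

  <ᵇ-relabel : ∀ {x y} → S x → S y → (f x <ᵇ f y) ≡ (x <ᵇ y)
  <ᵇ-relabel {x} {y} sx sy = det (<ᵇ-reflects-< (f x) (f y))
    (fromEquivalence (f-strictMono sx sy ∘ <ᵇ⇒< x y) (<⇒<ᵇ ∘ f-reflects-< sx sy))

  RowResult : Set
  RowResult = ℕ × List ℕ × Maybe ℕ

  relabelRow : RowResult → RowResult
  relabelRow (k , r , b) = k , map f r , Maybe.map f b

  EntriesIn : RowResult → Set
  EntriesIn (_ , r , b) = All S r × MaybeAll.All S b

  insRow-relabel : ∀ {x r} → S x → All S r → insRow (f x) (map f r) ≡ relabelRow (insRow x r)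
  insRow-relabel {x} {[]} sx [] = refl
  insRow-relabel {x} {y ∷ r} sx (sy ∷ sr) rewrite <ᵇ-relabel sx sy with x <ᵇ y
  ... | true = refl
  ... | false rewrite insRow-relabel sx sr = refl

  insRow-entries : ∀ {x r} → S x → All S r → EntriesIn (insRow x r)
  insRow-entries {x} {[]} sx [] = sx ∷ [] , nothing
  insRow-entries {x} {y ∷ r} sx (sy ∷ sr) with x <ᵇ y
  ... | true = sx ∷ sr , just sy
  ... | false with insRow-entries sx sr
  ...   | sr' , sb = sy ∷ sr' , sb

  relabelTableau : Tableau → Tableau
  relabelTableau = map (map f)

  insertFrom-relabel : ∀ {x from U} → S x → All (All S) U →
    insertFrom (f x) from (relabelTableau U) ≡ map₁ relabelTableau (insertFrom x from U)
  insertFrom-relabel {x} {from} {[]} sx [] = refl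
  insertFrom-relabel {x} {from} {r ∷ U} sx (sr ∷ sU)
    rewrite insRow-relabel sx sr with insRow x r | insRow-entries sx sr
  ... | k , r' , nothing | _ = refl
  ... | k , r' , just y | _ , just sy rewrite insertFrom-relabel {from = just k} sy sU = refl

  insertFrom-entries : ∀ {x from U} → S x → All (All S) U → All (All S) (proj₁ (insertFrom x from U))
  insertFrom-entries {x} {from} {[]} sx [] = (sx ∷ []) ∷ []
  insertFrom-entries {x} {from} {r ∷ U} sx (sr ∷ sU) with insRow x r | insRow-entries sx sr
  ... | k , r' , nothing | sr' , _ = sr' ∷ sU
  ... | k , r' , just y | sr' , just sy = sr' ∷ insertFrom-entries sy sU

  schensted-relabel : ∀ {U w} → All (All S) U → All S w →
    schensted (relabelTableau U) (map f w) ≡ map₁ relabelTableau (schensted U w)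
  schensted-relabel {U} {[]} sU [] = refl
  schensted-relabel {U} {x ∷ w} sU (sx ∷ sw)
    rewrite insertFrom-relabel {from = nothing} sx sU
          | schensted-relabel (insertFrom-entries {from = nothing} sx sU) sw = refl

  noLateralBumps-relabel : ∀ {w} → All S w → noLateralBumps (map f w) ≡ noLateralBumps w
  noLateralBumps-relabel sw = cong (not ∘ proj₂) (schensted-relabel [] sw)

noLateralBumps-Flat : ∀ a → noLateralBumps (Flat a) ≡ noLateralBumps a
noLateralBumps-Flat a =
  noLateralBumps-relabel (All.tabulate id)
  where open Relabelling (_∈ a) (rank a) (λ _ y∈a → rank-strictMono y∈a)

lateralBump-++ : ∀ U p q →
  proj₂ (schensted U (p ++ q)) ≡ proj₂ (schensted U p) ∨ proj₂ (schensted (proj₁ (schensted U p)) q)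
lateralBump-++ U [] q = refl
lateralBump-++ U (x ∷ p) q = begin
  l ∨ proj₂ (schensted U′ (p ++ q))                      ≡⟨ cong (l ∨_) (lateralBump-++ U′ p q) ⟩
  l ∨ (proj₂ (schensted U′ p) ∨ proj₂ (schensted U″ q))  ≡⟨ ∨-assoc l _ _ ⟨
  (l ∨ proj₂ (schensted U′ p)) ∨ proj₂ (schensted U″ q)  ∎
  where
  open ≡-Reasoning
  U′ : Tableau
  U′ = proj₁ (insertFrom x nothing U)
  U″ : Tableau
  U″ = proj₁ (schensted U′ p)
  l : Bool
  l = proj₂ (insertFrom x nothing U)

noLateralBumps-++ˡ : ∀ p q → T (noLateralBumps (p ++ q)) → T (noLateralBumps p)
noLateralBumps-++ˡ p q free = Equivalence.from T-not-≡
  (∨-conicalˡ _ _ (trans (sym (lateralBump-++ [] p q)) (Equivalence.to T-not-≡ free)))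

noLateralBumps-take : ∀ n w → T (noLateralBumps w) → T (noLateralBumps (take n w))
noLateralBumps-take n w free =
  noLateralBumps-++ˡ (take n w) (drop n w) (subst (T ∘ noLateralBumps) (sym (take++drop≡id n w)) free)

IsPerm⇒length : ∀ {m w} → IsPerm m w → length w ≡ m
IsPerm⇒length {m} w↭ = trans (↭-length w↭) (trans (length-map suc (upTo m)) (length-upTo m))

IsPerm⇒Unique : ∀ {m w} → IsPerm m w → Unique w
IsPerm⇒Unique {m} w↭ = Unique-resp-↭ (↭-sym w↭) (Unique.map⁺ suc-injective (Unique.upTo⁺ m))

lemma3p9 : (n : ℕ) → 1 ≤ n → (w : List ℕ) → V (suc n) w → V n (φ n w)
lemma3p9 n _ w (w↭ , w-free) = Flat-perm , Flat-free
  where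
  a : List ℕ
  a = take n w
  length-a : length a ≡ n
  length-a = trans (length-take n w)
    (m≤n⇒m⊓n≡m (≤-trans (n≤1+n n) (≤-reflexive (sym (IsPerm⇒length w↭)))))
  Flat-perm : IsPerm n (Flat a)
  Flat-perm = subst (λ m → IsPerm m (Flat a)) length-a
    (Flat-isPerm (Unique.take⁺ n (IsPerm⇒Unique w↭)))
  Flat-free : T (noLateralBumps (Flat a))
  Flat-free = subst T (sym (noLateralBumps-Flat a)) (noLateralBumps-take n w w-free)
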